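{- Let $G$ be a graph with vertex set $V$ and let $W\subseteq V$ be reducible in $G$. Then $\Gamma_W$ is a composition of combinatorial reduction rules: there is an applicable combinatorial reduction strategy $(\gamma_1,\dots,\gamma_k)$ of $G$ with domain $W$ such that $\gamma_k\circ\cdots\circ\gamma_1(G)=\Gamma_W(G)$.
   Context: A graph is a finite graph with vertex set $V$, no multiple edges, in which each vertex may or may not carry a loop. Its adjacency matrix $A$ is the symmetric $V\times V$ matrix over $\mathbf{F}_2$ with $A_{vw}=1$ iff $v\ne w$ are adjacent and $A_{vv}=1$ iff $v$ has a loop. Let $\mathcal{V}$ be the $\mathbf{F}_2$-vector space with basis $V$, $\mathcal{E}(x,y)=x^TAy$, $\langle W\rangle$ the span of $W$, $\langle W\rangle^{\perp}=\{x:\mathcal{E}(x,w)=0\ \forall w\in\langle W\rangle\}$. $W$ is reducible in $G$ if $\langle W\rangle+\langle W\rangle^{\perp}=\mathcal{V}$. For reducible $W$, $\Gamma_W(G)$ is the graph on $V\setminus W$ in which $v,w\in V\setminus W$ (possibly $v=w$, concerning a loop) are adjacent iff $\mathcal{E}(v',w')=1$, where $v',w'\in\langle W\rangle^{\perp}$ are any vectors with $v-v',w-w'\in\langle W\rangle$ (independent of the choice). Combinatorial reduction rules (domain listed first in block form, arithmetic over $\mathbf{F}_2$): $\mathrm{gpr}_v$ applies iff $v$ has a loop; domain $\{v\}$; if $A=\begin{pmatrix}1&q\\ q^T&R\end{pmatrix}$, result has adjacency matrix $R-q^Tq$ on $V\setminus\{v\}$. $\mathrm{gdr}_{v_1,v_2}$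 applies iff $v_1\neq v_2$ are loopless and adjacent; domain $\{v_1,v_2\}$; if $A=\begin{pmatrix}J&Q\\ Q^T&R\end{pmatrix}$ with $J=\begin{pmatrix}0&1\\1&0\end{pmatrix}$, result has adjacency matrix $R-Q^TJQ$. $\mathrm{gnr}_v$ applies iff $v$ is loopless with no neighbours; domain $\{v\}$; result is $G$ with $v$ deleted. A combinatorial reduction strategy is a sequence $(\gamma_1,\dots,\gamma_k)$ of rules; it is applicable if each $\gamma_i$ applies to $\gamma_{i-1}\circ\cdots\circ\gamma_1(G)$; its domain is the set of all vertices removed. -}

module Defs where

open import Data.Nat using (ℕ; zero; suc)
open import Data.Bool using (Bool; true; false; _∧_; _xor_; not; if_then_else_)
open import Data.Fin using (Fin; zero; suc; _≟_)
open import Data.Fin.Subset using (Subset; _∈_; _∉_)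
open import Data.List using (List; []; _∷_)
open import Data.List.Relation.Unary.Any using (Any)
open import Data.Product using (Σ; ∃; _×_; _,_)
open import Relation.Binary.PropositionalEquality using (_≡_)
open import Relation.Nullary using (¬_; yes; no)
open import Function.Bundles using (_⇔_)

-- F₂ = Bool with xor as addition and ∧ as multiplication.
-- Vectors of 𝒱 = F₂^V with V = Fin n are functions Fin n → Bool.

Vec₂ : ℕ → Set
Vec₂ n = Fin n → Bool

xsum : ∀ {n} → (Fin n → Bool) → Bool
xsum {zero}  f = false
xsum {suc n} f = f zero xor xsum (λ i → f (suc i))

_+ᵥ_ : ∀ {n} → Vec₂ n → Vec₂ n → Vec₂ n
(x +ᵥ y) v = x v xor y v

δ : ∀ {n} → Fin n → Fin n → Bool
δ w v with w ≟ v
... | yes _ = true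
... | no  _ = false

-- adjacency matrices (arbitrary Bool matrices; symmetry imposed separately)
Mat : ℕ → Set
Mat n = Fin n → Fin n → Bool

Symmetric : ∀ {n} → Mat n → Set
Symmetric A = ∀ v w → A v w ≡ A w v

ℰ : ∀ {n} → Mat n → Vec₂ n → Vec₂ n → Bool
ℰ A x y = xsum (λ v → xsum (λ w → x v ∧ (A v w ∧ y w)))

InSpan : ∀ {n} → Subset n → Vec₂ n → Set
InSpan {n} W x =
  Σ (Fin n → Bool) λ c →
    (∀ w → c w ≡ true → w ∈ W) × (∀ v → x v ≡ xsum (λ w → c w ∧ δ w v))

InPerp : ∀ {n} → Mat n → Subset n → Vec₂ n → Set
InPerp A W x = ∀ y → InSpan W y → ℰ A x y ≡ false

Reducible : ∀ {n} → Mat n → Subset n → Set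
Reducible {n} A W =
  ∀ (x : Vec₂ n) → Σ (Vec₂ n) λ a → Σ (Vec₂ n) λ b →
    InSpan W a × InPerp A W b × (∀ v → x v ≡ (a +ᵥ b) v)

-- Graphs on a subset of the ambient labelled vertex set Fin n:
-- 'alive' is the current vertex set, 'adj' the adjacency matrix
-- (only entries between alive vertices are meaningful).

record LGraph (n : ℕ) : Set where
  constructor lgraph
  field
    alive : Fin n → Bool
    adj   : Mat n
open LGraph public

full : ∀ {n} → Mat n → LGraph n
full A = lgraph (λ _ → true) A

_≅_ : ∀ {n} → LGraph n → LGraph n → Set
G ≅ H = (∀ v → alive G v ≡ alive H v) ×
        (∀ v w → alive G v ≡ true → alive G w ≡ true → adj G v w ≡ adj H v w)

IsΓ : ∀ {n} → Mat n → Subset n → LGraph n → Set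
IsΓ {n} A W H =
  (∀ v → (alive H v ≡ true) ⇔ (v ∉ W)) ×
  (∀ v w → v ∉ W → w ∉ W → (v' w' : Vec₂ n) →
     InPerp A W v' → InPerp A W w' →
     InSpan W (δ v +ᵥ v') → InSpan W (δ w +ᵥ w') →
     adj H v w ≡ ℰ A v' w')

data Rule (n : ℕ) : Set where
  gpr : Fin n → Rule n
  gdr : Fin n → Fin n → Rule n
  gnr : Fin n → Rule n

remove : ∀ {n} → Fin n → (Fin n → Bool) → (Fin n → Bool)
remove u S v = S v ∧ not (δ u v)

Applies : ∀ {n} → LGraph n → Rule n → Set
Applies G (gpr v) = alive G v ≡ true × adj G v v ≡ true
Applies G (gdr v₁ v₂) =
  ¬ (v₁ ≡ v₂) × alive G v₁ ≡ true × alive G v₂ ≡ true ×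
  adj G v₁ v₁ ≡ false × adj G v₂ v₂ ≡ false × adj G v₁ v₂ ≡ true
Applies G (gnr v) =
  alive G v ≡ true × adj G v v ≡ false ×
  (∀ w → alive G w ≡ true → ¬ (w ≡ v) → adj G v w ≡ false)

-- result of applying a rule (over F₂, subtraction = xor)
apply : ∀ {n} → LGraph n → Rule n → LGraph n
apply G (gpr v) =
  lgraph (remove v (alive G))
         (λ x y → adj G x y xor (adj G v x ∧ adj G v y))
apply G (gdr v₁ v₂) =
  lgraph (remove v₂ (remove v₁ (alive G)))
         (λ x y → adj G x y xor ((adj G v₁ x ∧ adj G v₂ y) xor (adj G v₂ x ∧ adj G v₁ y)))
apply G (gnr v) = lgraph (remove v (alive G)) (adj G)

-- strategies (γ₁,…,γₖ) as lists, applied left to right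
run : ∀ {n} → LGraph n → List (Rule n) → LGraph n
run G []       = G
run G (γ ∷ γs) = run (apply G γ) γs

Applicable : ∀ {n} → LGraph n → List (Rule n) → Set
Applicable G []       = Data.Unit.⊤ where import Data.Unit
Applicable G (γ ∷ γs) = Applies G γ × Applicable (apply G γ) γs

RuleDom : ∀ {n} → Fin n → Rule n → Set
RuleDom u (gpr v)     = u ≡ v
RuleDom u (gdr v₁ v₂) = (u ≡ v₁) Data.Sum.⊎ (u ≡ v₂) where import Data.Sum
RuleDom u (gnr v)     = u ≡ v

InDomain : ∀ {n} → Fin n → List (Rule n) → Set
InDomain u γs = Any (RuleDom u) γs

module Submission where

-- Throughout the reduction we keep, for the current graph H
-- (a vertex set S ⊆ V with an adjacency matrix), a family of representatives
-- rep v ∈ 𝒱 for the live vertices v ∈ S such that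
--   * rep v agrees with the basis vector e_v on S,
--   * rep v is ℰ-orthogonal to e_d for every deleted vertex d, and
--   * the adjacency of H is ℰ(rep v, rep w);
-- moreover all deleted vertices lie in W.  For G itself take rep v = e_v.
-- Each rule gpr/gdr/gnr with domain in W preserves this, the representatives
-- changing by an elementary row operation (rep x + c·rep p).  Conversely, as
-- long as a vertex of W is alive some such rule applies: a loop in W gives
-- gpr, an edge in W gives gdr, and otherwise reducibility of W forces a live
-- vertex of W to be isolated, giving gnr.  Since each rule deletes a vertex,
-- iterating deletes exactly W, and the final representatives are precisely the
-- vectors v′ ∈ ⟨W⟩^⊥ with v − v′ ∈ ⟨W⟩ of the definition of Γ_W(G).

open import Defs
open import Data.Nat using (ℕ; zero; suc; _+_; _≤_; _<_; z≤n; s≤s)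
open import Data.Nat.Properties using (+-mono-≤; +-mono-≤-<; <-≤-trans; ≤-pred; n<1+n)
open import Data.Bool using (Bool; true; false; _∧_; _xor_; if_then_else_)
open import Data.Bool.Properties
  using (∧-assoc; ∧-comm; ∧-zeroʳ; ∧-identityʳ; ∧-distribˡ-xor; ∧-distribʳ-xor;
         xor-assoc; xor-comm; xor-identityʳ; xor-same; ¬-not)
  renaming (_≟_ to _≟ᵇ_)
open import Data.Fin using (Fin; zero; suc; _≟_)
open import Data.Fin.Properties using (suc-injective; any?)
open import Data.Fin.Subset using (Subset; _∈_; _∉_)
open import Data.Fin.Subset.Properties using (_∈?_)
open import Data.List using (List; []; _∷_)
open import Data.List.Relation.Unary.Any using (here; there)
open import Data.Product using (Σ; _×_; _,_; proj₁; proj₂)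
open import Data.Sum using (_⊎_; inj₁; inj₂)
open import Data.Unit using (tt)
open import Function.Bundles using (_⇔_; mk⇔)
open import Relation.Binary.PropositionalEquality
open import Relation.Nullary using (¬_; Dec; yes; no; contradiction)
open import Relation.Nullary.Decidable using (_×-dec_)

xor-∧-zero : ∀ a c {q} → q ≡ false → a xor (c ∧ q) ≡ a
xor-∧-zero a c refl = trans (cong (a xor_) (∧-zeroʳ c)) (xor-identityʳ a)

xor-self-∧-true : ∀ a → a xor (a ∧ true) ≡ false
xor-self-∧-true a = trans (cong (a xor_) (∧-identityʳ a)) (xor-same a)

xor≡false⇒≡ : ∀ {a b} → a xor b ≡ false → a ≡ b
xor≡false⇒≡ {false} {false} _ = refl
xor≡false⇒≡ {true}  {true}  _ = refl

xsum-cong : ∀ {n} {f g : Fin n → Bool} → (∀ i → f i ≡ g i) → xsum f ≡ xsum g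
xsum-cong {zero}  f≗g = refl
xsum-cong {suc n} f≗g = cong₂ _xor_ (f≗g zero) (xsum-cong (λ i → f≗g (suc i)))

xsum-zero : ∀ {n} (f : Fin n → Bool) → (∀ i → f i ≡ false) → xsum f ≡ false
xsum-zero {zero}  f f≗0 = refl
xsum-zero {suc n} f f≗0 rewrite f≗0 zero = xsum-zero (λ i → f (suc i)) (λ i → f≗0 (suc i))

xsum-xor : ∀ {n} (f g : Fin n → Bool) → xsum (λ i → f i xor g i) ≡ xsum f xor xsum g
xsum-xor {zero}  f g = refl
xsum-xor {suc n} f g = begin
  (f zero xor g zero) xor xsum (λ i → f (suc i) xor g (suc i))
    ≡⟨ cong ((f zero xor g zero) xor_) (xsum-xor (λ i → f (suc i)) (λ i → g (suc i))) ⟩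
  (f zero xor g zero) xor (F xor G)
    ≡⟨ interchange (f zero) (g zero) F G ⟩
  (f zero xor F) xor (g zero xor G) ∎
  where
  open ≡-Reasoning
  F : Bool
  F = xsum (λ i → f (suc i))
  G : Bool
  G = xsum (λ i → g (suc i))
  interchange : ∀ a b c d → (a xor b) xor (c xor d) ≡ (a xor c) xor (b xor d)
  interchange a b c d = begin
    (a xor b) xor (c xor d) ≡⟨ xor-assoc a b (c xor d) ⟩
    a xor (b xor (c xor d)) ≡⟨ cong (a xor_) (sym (xor-assoc b c d)) ⟩
    a xor ((b xor c) xor d) ≡⟨ cong (λ t → a xor (t xor d)) (xor-comm b c) ⟩
    a xor ((c xor b) xor d) ≡⟨ cong (a xor_) (xor-assoc c b d) ⟩
    a xor (c xor (b xor d)) ≡⟨ sym (xor-assoc a c (b xor d)) ⟩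
    (a xor c) xor (b xor d) ∎

xsum-∧ˡ : ∀ {n} c (f : Fin n → Bool) → xsum (λ i → c ∧ f i) ≡ c ∧ xsum f
xsum-∧ˡ {zero}  c f = sym (∧-zeroʳ c)
xsum-∧ˡ {suc n} c f =
  trans (cong ((c ∧ f zero) xor_) (xsum-∧ˡ c (λ i → f (suc i))))
        (sym (∧-distribˡ-xor c (f zero) _))

xsum-swap : ∀ {n m} (f : Fin n → Fin m → Bool) →
  xsum (λ i → xsum (λ j → f i j)) ≡ xsum (λ j → xsum (λ i → f i j))
xsum-swap {zero}  f = sym (xsum-zero (λ j → xsum (λ i → f i j)) (λ j → refl))
xsum-swap {suc n} f =
  trans (cong (xsum (f zero) xor_) (xsum-swap (λ i j → f (suc i) j)))
        (sym (xsum-xor (f zero) (λ j → xsum (λ i → f (suc i) j))))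

δ-refl : ∀ {n} (v : Fin n) → δ v v ≡ true
δ-refl v with v ≟ v
... | yes _   = refl
... | no v≢v = contradiction refl v≢v

δ-≢ : ∀ {n} {w v : Fin n} → ¬ w ≡ v → δ w v ≡ false
δ-≢ {w = w} {v} w≢v with w ≟ v
... | yes w≡v = contradiction w≡v w≢v
... | no _    = refl

δ-true : ∀ {n} {w v : Fin n} → δ w v ≡ true → w ≡ v
δ-true {w = w} {v} δ≡true with w ≟ v
... | yes w≡v = w≡v
δ-true () | no _

δ-by-cases : ∀ {n} {w v : Fin n} {b : Bool} → (w ≡ v → b ≡ true) → (¬ w ≡ v → b ≡ false) →
  δ w v ≡ b
δ-by-cases {w = w} {v} equal different with w ≟ v
... | yes w≡v = sym (equal w≡v)
... | no w≢v  = sym (different w≢v)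

δ-sym : ∀ {n} (w v : Fin n) → δ w v ≡ δ v w
δ-sym w v = δ-by-cases (λ { refl → δ-refl w }) (λ w≢v → δ-≢ (λ v≡w → w≢v (sym v≡w)))

δ-suc : ∀ {n} (i j : Fin n) → δ (suc i) (suc j) ≡ δ i j
δ-suc i j = δ-by-cases (λ si≡sj → cong-δ (suc-injective si≡sj)) (λ si≢sj → δ-≢ (λ { refl → si≢sj refl }))
  where
  cong-δ : i ≡ j → δ i j ≡ true
  cong-δ refl = δ-refl i

xsum-δ : ∀ {n} (w : Fin n) (f : Fin n → Bool) → xsum (λ u → δ w u ∧ f u) ≡ f w
xsum-δ {suc n} zero f =
  trans (cong (f zero xor_) (xsum-zero (λ i → δ zero (suc i) ∧ f (suc i)) (λ i → refl)))
        (xor-identityʳ (f zero))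
xsum-δ {suc n} (suc w) f =
  trans (xsum-cong (λ i → cong (_∧ f (suc i)) (δ-suc w i))) (xsum-δ w (λ i → f (suc i)))

xsum-δ′ : ∀ {n} (w : Fin n) (f : Fin n → Bool) → xsum (λ u → f u ∧ δ u w) ≡ f w
xsum-δ′ w f =
  trans (xsum-cong (λ u → trans (∧-comm (f u) (δ u w)) (cong (_∧ f u) (δ-sym u w)))) (xsum-δ w f)

_⊆ᵇ_ : ∀ {n} → (Fin n → Bool) → (Fin n → Bool) → Set
T ⊆ᵇ S = ∀ v → T v ≡ true → S v ≡ true

⊆ᵇ-dead : ∀ {n} {T S : Fin n → Bool} {v} → T ⊆ᵇ S → S v ≡ false → T v ≡ false
⊆ᵇ-dead {v = v} T⊆S Sv = ¬-not (λ Tv → contradiction (trans (sym (T⊆S v Tv)) Sv) λ ())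

remove-⊆ : ∀ {n} (u : Fin n) S → remove u S ⊆ᵇ S
remove-⊆ u S v with S v
... | true  = λ _ → refl
... | false = λ ()

remove-self : ∀ {n} (u : Fin n) S → remove u S u ≡ false
remove-self u S rewrite δ-refl u = ∧-zeroʳ (S u)

remove-≢ : ∀ {n} {u : Fin n} {S v} → remove u S v ≡ true → ¬ u ≡ v
remove-≢ {u = u} {S} u-alive refl = contradiction (trans (sym u-alive) (remove-self u S)) λ ()

remove-dead : ∀ {n} (u : Fin n) S {v} → remove u S v ≡ false → S v ≡ false ⊎ u ≡ v
remove-dead u S {v} dead with S v | δ u v in δuv
... | false | _    = inj₁ refl
... | true  | true = inj₂ (δ-true δuv)

apply-⊆ : ∀ {n} (G : LGraph n) γ → alive (apply G γ) ⊆ᵇ alive G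
apply-⊆ G (gpr p)   = remove-⊆ p (alive G)
apply-⊆ G (gdr p q) v = λ v-alive → remove-⊆ p (alive G) v (remove-⊆ q (remove p (alive G)) v v-alive)
apply-⊆ G (gnr p)   = remove-⊆ p (alive G)

removed-by : ∀ {n} (G : LGraph n) γ {v} → RuleDom v γ → alive (apply G γ) v ≡ false
removed-by G (gpr p)   refl        = remove-self p (alive G)
removed-by G (gdr p q) (inj₁ refl) = ⊆ᵇ-dead (remove-⊆ q (remove p (alive G))) (remove-self p (alive G))
removed-by G (gdr p q) (inj₂ refl) = remove-self q (remove p (alive G))
removed-by G (gnr p)   refl        = remove-self p (alive G)

removes-only : ∀ {n} (G : LGraph n) γ {v} → alive G v ≡ true → alive (apply G γ) v ≡ false →
  RuleDom v γ
removes-only G (gpr p) v-alive v-dead with remove-dead p (alive G) v-dead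
... | inj₁ dead′ = contradiction (trans (sym v-alive) dead′) λ ()
... | inj₂ p≡v   = sym p≡v
removes-only G (gdr p q) v-alive v-dead with remove-dead q (remove p (alive G)) v-dead
... | inj₂ q≡v   = inj₂ (sym q≡v)
... | inj₁ dead′ with remove-dead p (alive G) dead′
...   | inj₁ dead″ = contradiction (trans (sym v-alive) dead″) λ ()
...   | inj₂ p≡v   = inj₁ (sym p≡v)
removes-only G (gnr p) v-alive v-dead with remove-dead p (alive G) v-dead
... | inj₁ dead′ = contradiction (trans (sym v-alive) dead′) λ ()
... | inj₂ p≡v   = sym p≡v

run-⊆ : ∀ {n} (G : LGraph n) γs → alive (run G γs) ⊆ᵇ alive G
run-⊆ G []       v v-alive = v-alive
run-⊆ G (γ ∷ γs) v v-alive = apply-⊆ G γ v (run-⊆ (apply G γ) γs v v-alive)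

domain-dead : ∀ {n} (G : LGraph n) γs {v} → InDomain v γs → alive (run G γs) v ≡ false
domain-dead G (γ ∷ γs) (here v∈γ)   = ⊆ᵇ-dead (run-⊆ (apply G γ) γs) (removed-by G γ v∈γ)
domain-dead G (γ ∷ γs) (there v∈γs) = domain-dead (apply G γ) γs v∈γs

dead-domain : ∀ {n} (G : LGraph n) γs {v} → alive G v ≡ true → alive (run G γs) v ≡ false →
  InDomain v γs
dead-domain G []       v-alive v-dead = contradiction (trans (sym v-alive) v-dead) λ ()
dead-domain G (γ ∷ γs) {v} v-alive v-dead with alive (apply G γ) v in alive-after-γ
... | true  = there (dead-domain (apply G γ) γs alive-after-γ v-dead)
... | false = here (removes-only G γ v-alive alive-after-γ)

bit : Bool → ℕ
bit b = if b then 1 else 0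

bit-≤ : ∀ {a b} → (a ≡ true → b ≡ true) → bit a ≤ bit b
bit-≤ {false}        _   = z≤n
bit-≤ {true} {true}  _   = s≤s z≤n
bit-≤ {true} {false} a⇒b = contradiction (a⇒b refl) λ ()

count : ∀ {n} → (Fin n → Bool) → ℕ
count {zero}  S = 0
count {suc n} S = bit (S zero) + count (λ i → S (suc i))

count-≤ : ∀ {n} {T S : Fin n → Bool} → T ⊆ᵇ S → count T ≤ count S
count-≤ {zero}  T⊆S = z≤n
count-≤ {suc n} T⊆S = +-mono-≤ (bit-≤ (T⊆S zero)) (count-≤ (λ i → T⊆S (suc i)))

count-< : ∀ {n} {T S : Fin n → Bool} {u} → T ⊆ᵇ S → S u ≡ true → T u ≡ false → count T < count S
count-< {suc n} {u = zero} T⊆S Su Tu rewrite Su | Tu = s≤s (count-≤ (λ i → T⊆S (suc i)))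
count-< {suc n} {u = suc u} T⊆S Su Tu =
  +-mono-≤-< (bit-≤ (T⊆S zero)) (count-< (λ i → T⊆S (suc i)) Su Tu)

apply-shrinks : ∀ {n} (G : LGraph n) γ → Applies G γ → count (alive (apply G γ)) < count (alive G)
apply-shrinks G γ@(gpr p)   (p-alive , _)     = count-< (apply-⊆ G γ) p-alive (removed-by G γ refl)
apply-shrinks G γ@(gdr p q) (_ , p-alive , _) = count-< (apply-⊆ G γ) p-alive (removed-by G γ (inj₁ refl))
apply-shrinks G γ@(gnr p)   (p-alive , _)     = count-< (apply-⊆ G γ) p-alive (removed-by G γ refl)

_·_ : ∀ {n} → Bool → Vec₂ n → Vec₂ n
(c · x) v = c ∧ x v

infixr 25 _·_

span-of-support : ∀ {n} (W : Subset n) (y : Vec₂ n) → (∀ w → y w ≡ true → w ∈ W) → InSpan W y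
span-of-support W y supp = y , supp , λ v → sym (xsum-δ′ v y)

span-vanishes : ∀ {n} {W : Subset n} {y : Vec₂ n} → InSpan W y → ∀ u → u ∉ W → y u ≡ false
span-vanishes {W = W} (c , c⊆W , y≡Σc) u u∉W = trans (y≡Σc u) (xsum-zero _ term)
  where
  term : ∀ w → c w ∧ δ w u ≡ false
  term w with c w in cw | δ w u in δwu
  ... | true  | true  = contradiction (subst (_∈ W) (δ-true δwu) (c⊆W w cw)) u∉W
  ... | true  | false = refl
  ... | false | _     = refl

module Form {n : ℕ} (A : Mat n) (symA : Symmetric A) where

  row : Vec₂ n → Vec₂ n
  row y v = xsum (λ w → A v w ∧ y w)

  ℰ-row : ∀ x y → ℰ A x y ≡ xsum (λ v → x v ∧ row y v)
  ℰ-row x y = xsum-cong (λ v → xsum-∧ˡ (x v) (λ w → A v w ∧ y w))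

  ℰ-congʳ : ∀ x {y z} → (∀ w → y w ≡ z w) → ℰ A x y ≡ ℰ A x z
  ℰ-congʳ x y≗z = xsum-cong (λ v → xsum-cong (λ w → cong (λ t → x v ∧ (A v w ∧ t)) (y≗z w)))

  ℰ-sym : ∀ x y → ℰ A x y ≡ ℰ A y x
  ℰ-sym x y = trans (xsum-swap (λ v w → x v ∧ (A v w ∧ y w)))
                    (xsum-cong λ w → xsum-cong λ v → swap (x v) (y w) (symA v w))
    where
    swap : ∀ a b {c d} → c ≡ d → a ∧ (c ∧ b) ≡ b ∧ (d ∧ a)
    swap a b {c} refl = begin
      a ∧ (c ∧ b) ≡⟨ ∧-comm a (c ∧ b) ⟩
      (c ∧ b) ∧ a ≡⟨ cong (_∧ a) (∧-comm c b) ⟩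
      (b ∧ c) ∧ a ≡⟨ ∧-assoc b c a ⟩
      b ∧ (c ∧ a) ∎
      where open ≡-Reasoning

  ℰ-+ˡ : ∀ x y z → ℰ A (x +ᵥ y) z ≡ ℰ A x z xor ℰ A y z
  ℰ-+ˡ x y z = begin
    ℰ A (x +ᵥ y) z
      ≡⟨ ℰ-row (x +ᵥ y) z ⟩
    xsum (λ v → (x v xor y v) ∧ row z v)
      ≡⟨ xsum-cong (λ v → ∧-distribʳ-xor (row z v) (x v) (y v)) ⟩
    xsum (λ v → (x v ∧ row z v) xor (y v ∧ row z v))
      ≡⟨ xsum-xor (λ v → x v ∧ row z v) (λ v → y v ∧ row z v) ⟩
    xsum (λ v → x v ∧ row z v) xor xsum (λ v → y v ∧ row z v)
      ≡⟨ sym (cong₂ _xor_ (ℰ-row x z) (ℰ-row y z)) ⟩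
    ℰ A x z xor ℰ A y z
      ∎
    where open ≡-Reasoning

  ℰ-·ˡ : ∀ c x z → ℰ A (c · x) z ≡ c ∧ ℰ A x z
  ℰ-·ˡ c x z = begin
    ℰ A (c · x) z                          ≡⟨ ℰ-row (c · x) z ⟩
    xsum (λ v → (c ∧ x v) ∧ row z v)       ≡⟨ xsum-cong (λ v → ∧-assoc c (x v) (row z v)) ⟩
    xsum (λ v → c ∧ (x v ∧ row z v))       ≡⟨ xsum-∧ˡ c (λ v → x v ∧ row z v) ⟩
    c ∧ xsum (λ v → x v ∧ row z v)         ≡⟨ cong (c ∧_) (sym (ℰ-row x z)) ⟩
    c ∧ ℰ A x z                            ∎
    where open ≡-Reasoning

  ℰ-+ʳ : ∀ x y z → ℰ A z (x +ᵥ y) ≡ ℰ A z x xor ℰ A z y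
  ℰ-+ʳ x y z = trans (ℰ-sym z (x +ᵥ y)) (trans (ℰ-+ˡ x y z) (cong₂ _xor_ (ℰ-sym x z) (ℰ-sym y z)))

  ℰ-·ʳ : ∀ c x z → ℰ A z (c · x) ≡ c ∧ ℰ A z x
  ℰ-·ʳ c x z = trans (ℰ-sym z (c · x)) (trans (ℰ-·ˡ c x z) (cong (c ∧_) (ℰ-sym x z)))

  ℰ-shiftˡ : ∀ x c p z → ℰ A (x +ᵥ c · p) z ≡ ℰ A x z xor (c ∧ ℰ A p z)
  ℰ-shiftˡ x c p z = trans (ℰ-+ˡ x (c · p) z) (cong (ℰ A x z xor_) (ℰ-·ˡ c p z))

  ℰ-shiftʳ : ∀ x c p z → ℰ A z (x +ᵥ c · p) ≡ ℰ A z x xor (c ∧ ℰ A z p)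
  ℰ-shiftʳ x c p z = trans (ℰ-+ʳ x (c · p) z) (cong (ℰ A z x xor_) (ℰ-·ʳ c p z))

  ℰ-shift-⊥ : ∀ x c p z → ℰ A z p ≡ false → ℰ A (x +ᵥ c · p) z ≡ ℰ A x z
  ℰ-shift-⊥ x c p z z⊥p = trans (ℰ-shiftˡ x c p z) (xor-∧-zero (ℰ A x z) c (trans (ℰ-sym p z) z⊥p))

  ℰ-δˡ : ∀ w x → ℰ A (δ w) x ≡ row x w
  ℰ-δˡ w x = trans (ℰ-row (δ w) x) (xsum-δ w (row x))

  ℰ-δδ : ∀ v w → ℰ A (δ v) (δ w) ≡ A v w
  ℰ-δδ v w = trans (ℰ-δˡ v (δ w))
    (trans (xsum-cong (λ u → cong (A v u ∧_) (δ-sym w u))) (xsum-δ′ w (A v)))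

  ℰ-expandʳ : ∀ x y → ℰ A x y ≡ xsum (λ w → ℰ A x (δ w) ∧ y w)
  ℰ-expandʳ x y = begin
    ℰ A x y                              ≡⟨ ℰ-sym x y ⟩
    ℰ A y x                              ≡⟨ ℰ-row y x ⟩
    xsum (λ w → y w ∧ row x w)           ≡⟨ xsum-cong (λ w → ∧-comm (y w) (row x w)) ⟩
    xsum (λ w → row x w ∧ y w)           ≡⟨ xsum-cong (λ w → cong (_∧ y w) (sym δw-x)) ⟩
    xsum (λ w → ℰ A x (δ w) ∧ y w)       ∎
    where
    open ≡-Reasoning
    δw-x : ∀ {w} → ℰ A x (δ w) ≡ row x w
    δw-x {w} = trans (ℰ-sym x (δ w)) (ℰ-δˡ w x)

  OrthOff : (Fin n → Bool) → Vec₂ n → Set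
  OrthOff S x = ∀ d → S d ≡ false → ℰ A x (δ d) ≡ false

  AgreeOn : (Fin n → Bool) → Vec₂ n → Vec₂ n → Set
  AgreeOn S y z = ∀ u → S u ≡ true → y u ≡ z u

  ℰ-agree : ∀ {S} x {y z} → OrthOff S x → AgreeOn S y z → ℰ A x y ≡ ℰ A x z
  ℰ-agree {S} x {y} {z} x⊥ y≈z =
    trans (ℰ-expandʳ x y) (trans (xsum-cong term) (sym (ℰ-expandʳ x z)))
    where
    term : ∀ w → ℰ A x (δ w) ∧ y w ≡ ℰ A x (δ w) ∧ z w
    term w with S w in Sw
    ... | true  = cong (ℰ A x (δ w) ∧_) (y≈z w Sw)
    ... | false rewrite x⊥ w Sw = refl

  orth-shift : ∀ {S} x c p → OrthOff S x → OrthOff S p → OrthOff S (x +ᵥ c · p)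
  orth-shift x c p x⊥ p⊥ d Sd =
    trans (ℰ-shiftˡ x c p (δ d)) (trans (xor-∧-zero _ c (p⊥ d Sd)) (x⊥ d Sd))

  orth-remove : ∀ {S} x p → OrthOff S x → ℰ A x (δ p) ≡ false → OrthOff (remove p S) x
  orth-remove {S} x p x⊥ x⊥p d d-dead with remove-dead p S d-dead
  ... | inj₁ d-dead′ = x⊥ d d-dead′
  ... | inj₂ refl    = x⊥p

  agree-shift : ∀ {T y z p} c → AgreeOn T y z → (∀ u → T u ≡ true → p u ≡ false) →
    AgreeOn T (y +ᵥ c · p) z
  agree-shift {y = y} c y≈z p≈0 u Tu = trans (xor-∧-zero (y u) c (p≈0 u Tu)) (y≈z u Tu)

module Reduction {n : ℕ} (A : Mat n) (symA : Symmetric A) (W : Subset n) where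
  open Form A symA

  record Represents (H : LGraph n) : Set where
    field
      dead⊆W    : ∀ v → alive H v ≡ false → v ∈ W
      rep       : Fin n → Vec₂ n
      rep-agree : ∀ v → alive H v ≡ true → AgreeOn (alive H) (rep v) (δ v)
      rep-orth  : ∀ v → alive H v ≡ true → OrthOff (alive H) (rep v)
      rep-adj   : ∀ v w → alive H v ≡ true → alive H w ≡ true → ℰ A (rep v) (rep w) ≡ adj H v w

  initial : Represents (full A)
  initial = record
    { dead⊆W    = λ v ()
    ; rep       = δ
    ; rep-agree = λ v _ u _ → refl
    ; rep-orth  = λ v _ d ()
    ; rep-adj   = λ v w _ _ → ℰ-δδ v w
    }

  module Consequences {H : LGraph n} (R : Represents H) where
    open Represents R

    adj-sym : ∀ {v w} → alive H v ≡ true → alive H w ≡ true → adj H v w ≡ adj H w v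
    adj-sym {v} {w} v-alive w-alive =
      trans (sym (rep-adj v w v-alive w-alive))
            (trans (ℰ-sym (rep v) (rep w)) (rep-adj w v w-alive v-alive))

    ℰ-rep : ∀ x {p} → OrthOff (alive H) x → alive H p ≡ true → ℰ A x (δ p) ≡ ℰ A x (rep p)
    ℰ-rep x {p} x⊥ p-alive = ℰ-agree x x⊥ (λ u u-alive → sym (rep-agree p p-alive u u-alive))

    rep-row : ∀ {v u} → alive H v ≡ true → alive H u ≡ true → ℰ A (rep v) (δ u) ≡ adj H v u
    rep-row {v} {u} v-alive u-alive =
      trans (ℰ-rep (rep v) (rep-orth v v-alive) u-alive) (rep-adj v u v-alive u-alive)

    rep-vanishes : ∀ {p} → alive H p ≡ true → ∀ u → remove p (alive H) u ≡ true → rep p u ≡ false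
    rep-vanishes {p} p-alive u u-alive′ =
      trans (rep-agree p p-alive u (remove-⊆ p (alive H) u u-alive′))
            (δ-≢ (remove-≢ {u = p} {alive H} u-alive′))

    rep-restrict : ∀ {p v} → alive H v ≡ true → AgreeOn (remove p (alive H)) (rep v) (δ v)
    rep-restrict {p} {v} v-alive u u-alive′ = rep-agree v v-alive u (remove-⊆ p (alive H) u u-alive′)

    rep-span : ∀ {p} → alive H p ≡ true → p ∈ W → InSpan W (rep p)
    rep-span {p} p-alive p∈W = span-of-support W (rep p) support
      where
      support : ∀ w → rep p w ≡ true → w ∈ W
      support w rep-p-w with alive H w in w-alive
      ... | true  = subst (_∈ W) (δ-true (trans (sym (rep-agree p p-alive w w-alive)) rep-p-w)) p∈W
      ... | false = dead⊆W w w-alive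

    dead⊆W-remove : ∀ {p} → p ∈ W → ∀ v → remove p (alive H) v ≡ false → v ∈ W
    dead⊆W-remove {p} p∈W v v-dead with remove-dead p (alive H) v-dead
    ... | inj₁ v-dead′ = dead⊆W v v-dead′
    ... | inj₂ refl    = p∈W

  -- Pivoting on a looped vertex p replaces each representative by rep x + A′(p,x)·rep p.
  gpr-preserves : ∀ {H p} → Represents H → Applies H (gpr p) → p ∈ W → Represents (apply H (gpr p))
  gpr-preserves {H} {p} R (p-alive , p-loop) p∈W = record
    { dead⊆W    = dead⊆W-remove p∈W
    ; rep       = rep′
    ; rep-agree = λ x x-alive′ →
                    agree-shift (adj H p x) (rep-restrict (alive⇐ x-alive′)) (rep-vanishes p-alive)
    ; rep-orth  = orth′
    ; rep-adj   = adj′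
    }
    where
    open Represents R
    open Consequences R
    S : Fin n → Bool
    S = alive H

    alive⇐ : ∀ {x} → remove p S x ≡ true → S x ≡ true
    alive⇐ {x} = remove-⊆ p S x

    rep′ : Fin n → Vec₂ n
    rep′ x = rep x +ᵥ adj H p x · rep p

    rep′⊥p : ∀ x → S x ≡ true → ℰ A (rep′ x) (rep p) ≡ false
    rep′⊥p x x-alive = begin
      ℰ A (rep′ x) (rep p)
        ≡⟨ ℰ-shiftˡ (rep x) (adj H p x) (rep p) (rep p) ⟩
      ℰ A (rep x) (rep p) xor (adj H p x ∧ ℰ A (rep p) (rep p))
        ≡⟨ cong₂ (λ s t → s xor (adj H p x ∧ t))
                 (trans (rep-adj x p x-alive p-alive) (adj-sym x-alive p-alive))
                 (trans (rep-adj p p p-alive p-alive) p-loop) ⟩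
      adj H p x xor (adj H p x ∧ true)
        ≡⟨ xor-self-∧-true (adj H p x) ⟩
      false
        ∎
      where open ≡-Reasoning

    orth′ : ∀ x → remove p S x ≡ true → OrthOff (remove p S) (rep′ x)
    orth′ x x-alive′ = orth-remove (rep′ x) p rep′x⊥
      (trans (ℰ-rep (rep′ x) rep′x⊥ p-alive) (rep′⊥p x (alive⇐ x-alive′)))
      where
      rep′x⊥ : OrthOff S (rep′ x)
      rep′x⊥ = orth-shift (rep x) (adj H p x) (rep p) (rep-orth x (alive⇐ x-alive′)) (rep-orth p p-alive)

    adj′ : ∀ x y → remove p S x ≡ true → remove p S y ≡ true →
      ℰ A (rep′ x) (rep′ y) ≡ adj H x y xor (adj H p x ∧ adj H p y)
    adj′ x y x-alive′ y-alive′ = begin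
      ℰ A (rep′ x) (rep′ y)           ≡⟨ ℰ-shift-⊥ (rep x) (adj H p x) (rep p) (rep′ y) (rep′⊥p y y-alive) ⟩
      ℰ A (rep x) (rep′ y)            ≡⟨ ℰ-shiftʳ (rep y) (adj H p y) (rep p) (rep x) ⟩
      ℰ A (rep x) (rep y) xor (adj H p y ∧ ℰ A (rep x) (rep p))
        ≡⟨ cong₂ (λ s t → s xor (adj H p y ∧ t))
                 (rep-adj x y x-alive y-alive)
                 (trans (rep-adj x p x-alive p-alive) (adj-sym x-alive p-alive)) ⟩
      adj H x y xor (adj H p y ∧ adj H p x) ≡⟨ cong (adj H x y xor_) (∧-comm (adj H p y) (adj H p x)) ⟩
      adj H x y xor (adj H p x ∧ adj H p y) ∎
      where
      open ≡-Reasoning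
      x-alive : S x ≡ true
      x-alive = alive⇐ x-alive′
      y-alive : S y ≡ true
      y-alive = alive⇐ y-alive′

  -- Pivoting on an edge pq of loopless vertices replaces each representative by
  -- rep x + A′(q,x)·rep p + A′(p,x)·rep q.
  gdr-preserves : ∀ {H p q} → Represents H → Applies H (gdr p q) → p ∈ W → q ∈ W →
    Represents (apply H (gdr p q))
  gdr-preserves {H} {p} {q} R (_ , p-alive , q-alive , p-loopless , q-loopless , pq) p∈W q∈W = record
    { dead⊆W    = dead⊆W-remove′
    ; rep       = rep′
    ; rep-agree = agree′
    ; rep-orth  = orth′
    ; rep-adj   = adj′
    }
    where
    open Represents R
    open Consequences R
    S : Fin n → Bool
    S = alive H
    S′ : Fin n → Bool
    S′ = remove q (remove p S)

    alive⇐ : ∀ {x} → S′ x ≡ true → S x ≡ true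
    alive⇐ {x} x-alive′ = remove-⊆ p S x (remove-⊆ q (remove p S) x x-alive′)

    e-pp : ℰ A (rep p) (rep p) ≡ false
    e-pp = trans (rep-adj p p p-alive p-alive) p-loopless
    e-qq : ℰ A (rep q) (rep q) ≡ false
    e-qq = trans (rep-adj q q q-alive q-alive) q-loopless
    e-pq : ℰ A (rep p) (rep q) ≡ true
    e-pq = trans (rep-adj p q p-alive q-alive) pq
    e-qp : ℰ A (rep q) (rep p) ≡ true
    e-qp = trans (ℰ-sym (rep q) (rep p)) e-pq
    e-xp : ∀ {x} → S x ≡ true → ℰ A (rep x) (rep p) ≡ adj H p x
    e-xp x-alive = trans (rep-adj _ p x-alive p-alive) (adj-sym x-alive p-alive)
    e-xq : ∀ {x} → S x ≡ true → ℰ A (rep x) (rep q) ≡ adj H q x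
    e-xq x-alive = trans (rep-adj _ q x-alive q-alive) (adj-sym x-alive q-alive)

    rep″ : Fin n → Vec₂ n
    rep″ x = rep x +ᵥ adj H q x · rep p

    rep′ : Fin n → Vec₂ n
    rep′ x = rep″ x +ᵥ adj H p x · rep q

    rep′⊥p : ∀ x → S x ≡ true → ℰ A (rep′ x) (rep p) ≡ false
    rep′⊥p x x-alive = begin
      ℰ A (rep′ x) (rep p)    ≡⟨ ℰ-shiftˡ (rep″ x) (adj H p x) (rep q) (rep p) ⟩
      ℰ A (rep″ x) (rep p) xor (adj H p x ∧ ℰ A (rep q) (rep p))
        ≡⟨ cong₂ (λ s t → s xor (adj H p x ∧ t)) (ℰ-shiftˡ (rep x) (adj H q x) (rep p) (rep p)) e-qp ⟩
      (ℰ A (rep x) (rep p) xor (adj H q x ∧ ℰ A (rep p) (rep p))) xor (adj H p x ∧ true)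
        ≡⟨ cong (λ s → (s xor (adj H q x ∧ ℰ A (rep p) (rep p))) xor (adj H p x ∧ true)) (e-xp x-alive) ⟩
      (adj H p x xor (adj H q x ∧ ℰ A (rep p) (rep p))) xor (adj H p x ∧ true)
        ≡⟨ cong (_xor (adj H p x ∧ true)) (xor-∧-zero (adj H p x) (adj H q x) e-pp) ⟩
      adj H p x xor (adj H p x ∧ true) ≡⟨ xor-self-∧-true (adj H p x) ⟩
      false ∎
      where open ≡-Reasoning

    rep′⊥q : ∀ x → S x ≡ true → ℰ A (rep′ x) (rep q) ≡ false
    rep′⊥q x x-alive = begin
      ℰ A (rep′ x) (rep q)    ≡⟨ ℰ-shiftˡ (rep″ x) (adj H p x) (rep q) (rep q) ⟩
      ℰ A (rep″ x) (rep q) xor (adj H p x ∧ ℰ A (rep q) (rep q))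
        ≡⟨ xor-∧-zero (ℰ A (rep″ x) (rep q)) (adj H p x) e-qq ⟩
      ℰ A (rep″ x) (rep q)    ≡⟨ ℰ-shiftˡ (rep x) (adj H q x) (rep p) (rep q) ⟩
      ℰ A (rep x) (rep q) xor (adj H q x ∧ ℰ A (rep p) (rep q))
        ≡⟨ cong₂ (λ s t → s xor (adj H q x ∧ t)) (e-xq x-alive) e-pq ⟩
      adj H q x xor (adj H q x ∧ true) ≡⟨ xor-self-∧-true (adj H q x) ⟩
      false ∎
      where open ≡-Reasoning

    dead⊆W-remove′ : ∀ v → S′ v ≡ false → v ∈ W
    dead⊆W-remove′ v v-dead with remove-dead q (remove p S) v-dead
    ... | inj₁ v-dead′ = dead⊆W-remove p∈W v v-dead′
    ... | inj₂ refl    = q∈W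

    agree′ : ∀ x → S′ x ≡ true → AgreeOn S′ (rep′ x) (δ x)
    agree′ x x-alive′ =
      agree-shift (adj H p x) (agree-shift (adj H q x) restricted p-vanishes) q-vanishes
      where
      restricted : AgreeOn S′ (rep x) (δ x)
      restricted u u-alive′ = rep-agree x (alive⇐ x-alive′) u (alive⇐ u-alive′)
      p-vanishes : ∀ u → S′ u ≡ true → rep p u ≡ false
      p-vanishes u u-alive′ = trans (rep-agree p p-alive u (alive⇐ u-alive′))
        (δ-≢ (remove-≢ {u = p} {S} (remove-⊆ q (remove p S) u u-alive′)))
      q-vanishes : ∀ u → S′ u ≡ true → rep q u ≡ false
      q-vanishes u u-alive′ = trans (rep-agree q q-alive u (alive⇐ u-alive′))
        (δ-≢ (remove-≢ {u = q} {remove p S} u-alive′))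

    orth′ : ∀ x → S′ x ≡ true → OrthOff S′ (rep′ x)
    orth′ x x-alive′ =
      orth-remove (rep′ x) q
        (orth-remove (rep′ x) p rep′x⊥ (trans (ℰ-rep (rep′ x) rep′x⊥ p-alive) (rep′⊥p x x-alive)))
        (trans (ℰ-rep (rep′ x) rep′x⊥ q-alive) (rep′⊥q x x-alive))
      where
      x-alive : S x ≡ true
      x-alive = alive⇐ x-alive′
      rep′x⊥ : OrthOff S (rep′ x)
      rep′x⊥ = orth-shift (rep″ x) (adj H p x) (rep q)
        (orth-shift (rep x) (adj H q x) (rep p) (rep-orth x x-alive) (rep-orth p p-alive))
        (rep-orth q q-alive)

    adj′ : ∀ x y → S′ x ≡ true → S′ y ≡ true →
      ℰ A (rep′ x) (rep′ y) ≡ adj H x y xor ((adj H p x ∧ adj H q y) xor (adj H q x ∧ adj H p y))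
    adj′ x y x-alive′ y-alive′ = begin
      ℰ A (rep′ x) (rep′ y)    ≡⟨ ℰ-shift-⊥ (rep″ x) (adj H p x) (rep q) (rep′ y) (rep′⊥q y y-alive) ⟩
      ℰ A (rep″ x) (rep′ y)    ≡⟨ ℰ-shift-⊥ (rep x) (adj H q x) (rep p) (rep′ y) (rep′⊥p y y-alive) ⟩
      ℰ A (rep x) (rep′ y)     ≡⟨ ℰ-shiftʳ (rep″ y) (adj H p y) (rep q) (rep x) ⟩
      ℰ A (rep x) (rep″ y) xor (adj H p y ∧ ℰ A (rep x) (rep q))
        ≡⟨ cong₂ (λ s t → s xor (adj H p y ∧ t))
                 (ℰ-shiftʳ (rep y) (adj H q y) (rep p) (rep x)) (e-xq x-alive) ⟩
      (ℰ A (rep x) (rep y) xor (adj H q y ∧ ℰ A (rep x) (rep p))) xor (adj H p y ∧ adj H q x)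
        ≡⟨ cong₂ (λ s t → (s xor (adj H q y ∧ t)) xor (adj H p y ∧ adj H q x))
                 (rep-adj x y x-alive y-alive) (e-xp x-alive) ⟩
      (adj H x y xor (adj H q y ∧ adj H p x)) xor (adj H p y ∧ adj H q x)
        ≡⟨ xor-assoc (adj H x y) _ _ ⟩
      adj H x y xor ((adj H q y ∧ adj H p x) xor (adj H p y ∧ adj H q x))
        ≡⟨ cong₂ (λ s t → adj H x y xor (s xor t))
                 (∧-comm (adj H q y) (adj H p x)) (∧-comm (adj H p y) (adj H q x)) ⟩
      adj H x y xor ((adj H p x ∧ adj H q y) xor (adj H q x ∧ adj H p y)) ∎
      where
      open ≡-Reasoning
      x-alive : S x ≡ true
      x-alive = alive⇐ x-alive′
      y-alive : S y ≡ true
      y-alive = alive⇐ y-alive′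

  gnr-preserves : ∀ {H p} → Represents H → Applies H (gnr p) → p ∈ W → Represents (apply H (gnr p))
  gnr-preserves {H} {p} R (p-alive , _ , p-isolated) p∈W = record
    { dead⊆W    = dead⊆W-remove p∈W
    ; rep       = rep
    ; rep-agree = λ x x-alive′ → rep-restrict (alive⇐ x-alive′)
    ; rep-orth  = orth′
    ; rep-adj   = λ x y x-alive′ y-alive′ → rep-adj x y (alive⇐ x-alive′) (alive⇐ y-alive′)
    }
    where
    open Represents R
    open Consequences R
    S : Fin n → Bool
    S = alive H

    alive⇐ : ∀ {x} → remove p S x ≡ true → S x ≡ true
    alive⇐ {x} = remove-⊆ p S x

    orth′ : ∀ x → remove p S x ≡ true → OrthOff (remove p S) (rep x)
    orth′ x x-alive′ = orth-remove (rep x) p (rep-orth x x-alive) (begin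
      ℰ A (rep x) (δ p) ≡⟨ rep-row x-alive p-alive ⟩
      adj H x p         ≡⟨ adj-sym x-alive p-alive ⟩
      adj H p x         ≡⟨ p-isolated x x-alive (λ x≡p → remove-≢ {u = p} {S} x-alive′ (sym x≡p)) ⟩
      false             ∎)
      where
      open ≡-Reasoning
      x-alive : S x ≡ true
      x-alive = alive⇐ x-alive′

  preserves : ∀ {H} → Represents H → ∀ γ → Applies H γ → (∀ v → RuleDom v γ → v ∈ W) →
    Represents (apply H γ)
  preserves R (gpr p)   applies dom⊆W = gpr-preserves R applies (dom⊆W p refl)
  preserves R (gdr p q) applies dom⊆W = gdr-preserves R applies (dom⊆W p (inj₁ refl)) (dom⊆W q (inj₂ refl))
  preserves R (gnr p)   applies dom⊆W = gnr-preserves R applies (dom⊆W p refl)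

  Pending : LGraph n → Fin n → Set
  Pending H v = alive H v ≡ true × v ∈ W

  pending? : ∀ H v → Dec (Pending H v)
  pending? H v = (alive H v ≟ᵇ true) ×-dec (v ∈? W)

  Independent : LGraph n → Set
  Independent H = ∀ {q r} → Pending H q → Pending H r → adj H q r ≡ false

  isolated : Reducible A W → ∀ {H} → Represents H → Independent H → ∀ {p} → Pending H p →
    ∀ u → alive H u ≡ true → adj H p u ≡ false
  isolated red {H} R independent {p} (p-alive , p∈W) u u-alive with red (Represents.rep R u)
  ... | a , b , a∈⟨W⟩ , b∈⟨W⟩⊥ , rep-u≡a+b = begin
    adj H p u                         ≡⟨ sym (rep-adj p u p-alive u-alive) ⟩
    ℰ A (rep p) (rep u)               ≡⟨ ℰ-congʳ (rep p) rep-u≡a+b ⟩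
    ℰ A (rep p) (a +ᵥ b)              ≡⟨ ℰ-+ʳ a b (rep p) ⟩
    ℰ A (rep p) a xor ℰ A (rep p) b   ≡⟨ cong₂ _xor_ rep-p⊥a rep-p⊥b ⟩
    false                             ∎
    where
    open ≡-Reasoning
    open Represents R
    open Consequences R

    rep-p⊥b : ℰ A (rep p) b ≡ false
    rep-p⊥b = trans (ℰ-sym (rep p) b) (b∈⟨W⟩⊥ (rep p) (rep-span p-alive p∈W))

    -- Expanding a in the basis, every term vanishes: off W since a does, on dead
    -- vertices by orthogonality, on live vertices of W by the absence of edges.
    term : ∀ w → ℰ A (rep p) (δ w) ∧ a w ≡ false
    term w with alive H w in w-alive | w ∈? W
    ... | false | _       rewrite rep-orth p p-alive w w-alive = refl
    ... | true  | yes w∈W rewrite rep-row p-alive w-alive | independent (p-alive , p∈W) (w-alive , w∈W) = refl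
    ... | true  | no w∉W  rewrite span-vanishes a∈⟨W⟩ w w∉W = ∧-zeroʳ _

    rep-p⊥a : ℰ A (rep p) a ≡ false
    rep-p⊥a = trans (ℰ-expandʳ (rep p) a) (xsum-zero _ term)

  data Progress (H : LGraph n) : Set where
    finished : (∀ v → v ∈ W → alive H v ≡ false) → Progress H
    advance  : ∀ γ → Applies H γ → (∀ v → RuleDom v γ → v ∈ W) → Progress H

  progress-loopless : Reducible A W → ∀ {H} → Represents H → ∀ {p} → Pending H p →
    (∀ {t} → Pending H t → adj H t t ≡ false) → Progress H
  progress-loopless red {H} R {p} (p-alive , p∈W) loopless
    with any? (λ q → any? (λ r → pending? H q ×-dec pending? H r ×-dec (adj H q r ≟ᵇ true)))
  ... | yes (q , r , q-pending , r-pending , qr) =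
    advance (gdr q r)
      (q≢r , proj₁ q-pending , proj₁ r-pending , loopless q-pending , loopless r-pending , qr)
      (λ { v (inj₁ refl) → proj₂ q-pending ; v (inj₂ refl) → proj₂ r-pending })
    where
    q≢r : ¬ q ≡ r
    q≢r refl = contradiction (trans (sym qr) (loopless q-pending)) λ ()
  ... | no no-edge =
    advance (gnr p)
      (p-alive , loopless (p-alive , p∈W) ,
       λ w w-alive _ → isolated red R independent (p-alive , p∈W) w w-alive)
      (λ { v refl → p∈W })
    where
    independent : Independent H
    independent {q} {r} q-pending r-pending = ¬-not (λ qr → no-edge (q , r , q-pending , r-pending , qr))

  progress : Reducible A W → ∀ {H} → Represents H → Progress H
  progress red {H} R with any? (pending? H)
  ... | no nothing-pending =
    finished (λ v v∈W → ¬-not (λ v-alive → nothing-pending (v , v-alive , v∈W)))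
  ... | yes (p , p-pending) with any? (λ q → pending? H q ×-dec (adj H q q ≟ᵇ true))
  ...   | yes (q , (q-alive , q∈W) , q-loop) = advance (gpr q) (q-alive , q-loop) (λ { v refl → q∈W })
  ...   | no no-loop = progress-loopless red R p-pending
            (λ {t} t-pending → ¬-not (λ t-loop → no-loop (t , t-pending , t-loop)))

  Exhausting : LGraph n → Set
  Exhausting H = Σ (List (Rule n)) λ γs →
    Applicable H γs × Represents (run H γs) × (∀ v → v ∈ W → alive (run H γs) v ≡ false)

  -- Iterate progress; each rule removes a vertex, so k > count (alive H) steps suffice.
  reduce : Reducible A W → ∀ k {H} → count (alive H) < k → Represents H → Exhausting H
  reduce red (suc k) {H} bound R with progress red R
  ... | finished done = [] , tt , R , done
  ... | advance γ applies γ⊆W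
    with reduce red k (<-≤-trans (apply-shrinks H γ applies) (≤-pred bound)) (preserves R γ applies γ⊆W)
  ...   | γs , applicable , R′ , done = γ ∷ γs , (applies , applicable) , R′ , done

  represents-Γ : ∀ {H} → Represents H → (∀ v → v ∈ W → alive H v ≡ false) → IsΓ A W H
  represents-Γ {H} R done = (λ v → mk⇔ (alive⇒∉W v) (∉W⇒alive v)) , adjacency
    where
    open Represents R

    alive⇒∉W : ∀ v → alive H v ≡ true → v ∉ W
    alive⇒∉W v v-alive v∈W = contradiction (trans (sym v-alive) (done v v∈W)) λ ()

    ∉W⇒alive : ∀ v → v ∉ W → alive H v ≡ true
    ∉W⇒alive v v∉W = ¬-not (λ v-dead → v∉W (dead⊆W v v-dead))

    perp-orth : ∀ x → InPerp A W x → OrthOff (alive H) x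
    perp-orth x x⊥ d d-dead = x⊥ (δ d)
      (span-of-support W (δ d) (λ w δdw → subst (_∈ W) (δ-true δdw) (dead⊆W d d-dead)))

    rep-agrees : ∀ {w w′} → w ∉ W → InSpan W (δ w +ᵥ w′) → AgreeOn (alive H) (rep w) w′
    rep-agrees {w} {w′} w∉W w∼w′ u u-alive =
      trans (rep-agree w (∉W⇒alive w w∉W) u u-alive)
            (xor≡false⇒≡ (span-vanishes w∼w′ u (alive⇒∉W u u-alive)))

    adjacency : ∀ v w → v ∉ W → w ∉ W → (v′ w′ : Vec₂ n) → InPerp A W v′ → InPerp A W w′ →
      InSpan W (δ v +ᵥ v′) → InSpan W (δ w +ᵥ w′) → adj H v w ≡ ℰ A v′ w′
    adjacency v w v∉W w∉W v′ w′ v′⊥ w′⊥ v∼v′ w∼w′ = begin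
      adj H v w            ≡⟨ sym (rep-adj v w (∉W⇒alive v v∉W) (∉W⇒alive w w∉W)) ⟩
      ℰ A (rep v) (rep w)  ≡⟨ ℰ-agree (rep v) (rep-orth v (∉W⇒alive v v∉W)) (rep-agrees w∉W w∼w′) ⟩
      ℰ A (rep v) w′       ≡⟨ ℰ-sym (rep v) w′ ⟩
      ℰ A w′ (rep v)       ≡⟨ ℰ-agree w′ (perp-orth w′ w′⊥) (rep-agrees v∉W v∼v′) ⟩
      ℰ A w′ v′            ≡⟨ ℰ-sym w′ v′ ⟩
      ℰ A v′ w′            ∎
      where open ≡-Reasoning

mainTheorem10 : (n : ℕ) (A : Mat n) → Symmetric A → (W : Subset n) →
    Reducible A W →
    Σ (List (Rule n)) λ γs →
      Applicable (full A) γs ×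
      (∀ v → InDomain v γs ⇔ (v ∈ W)) ×
      IsΓ A W (run (full A) γs)
mainTheorem10 n A symA W red =
  let open Reduction A symA W
      (γs , applicable , R , W-removed) = reduce red (suc (count (alive (full A)))) (n<1+n _) initial
      domain⇔W : ∀ v → InDomain v γs ⇔ (v ∈ W)
      domain⇔W v = mk⇔ (λ v∈γs → Represents.dead⊆W R v (domain-dead (full A) γs v∈γs))
                       (λ v∈W → dead-domain (full A) γs refl (W-removed v v∈W))
  in γs , applicable , domain⇔W , represents-Γ R W-removed
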